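{- Let $T$ be an unlabelled binary tree. The set of words in $\mathcal{A}^*$ that are postfix readings of right strict binary search trees of shape $T$ forms a single connected component of the quasi-crystal graph $\Gamma(\mathrm{hypo})$.
   Context: $\mathcal{A} = \{1,2,3,\ldots\}$ with the usual order; $\mathcal{A}^*$ the free monoid over $\mathcal{A}$. A right strict binary search tree is a rooted binary tree with nodes labelled by elements of $\mathcal{A}$ such that each node's label is $\ge$ every label in its left subtree and $<$ every label in its right subtree; its shape is the underlying unlabelled rooted binary tree (left/right children distinguished). The postfix traversal of a binary tree recursively traverses the left subtree of the root, then the right subtree, then visits the root; the postfix reading of a labelled tree is the word of labels in postfix order. Quasi-Kashiwara operators $\ddot e_i,\ddot f_i$ ($i\in\mathbb{N}$) on $\mathcal{A}^*$: if $u$ contains a letter $i+1$ somewhere to the left of a letter $i$, both are undefined; otherwise $\ddot e_i(u)$ replaces the leftmost $i+1$ by $i$ (undefined if none) and $\ddot f_i(u)$ replaces the rightmost $i$ by $i+1$ (undefined if none). $\Gamma(\mathrm{hypo})$ is the directed graph on $\mathcal{A}^*$ with an edge $u \to v$ labelled $i$ iff $v = \ddot f_i(u)$; connected components are those of the underlying undirected graph. -}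

module Defs where

open import Data.Nat using (ℕ; suc; _≤_; _<_)
open import Data.List using (List; []; _∷_; _++_; [_])
open import Data.List.Membership.Propositional using (_∉_)
open import Data.List.Relation.Unary.All using (All)
open import Data.Product using (Σ; ∃; _×_)
open import Relation.Binary.PropositionalEquality using (_≡_)
open import Relation.Nullary using (¬_)
open import Relation.Binary.Construct.Closure.Equivalence using (EqClosure)

-- Alphabet convention: the paper's alphabet A = {1,2,3,...} is encoded by ℕ,
-- the natural number k encoding the letter k+1 (an order isomorphism).
-- Likewise the operator index i : ℕ encodes the paper's index i+1, so that
-- our letters i and suc i encode the paper's letters i+1 and i+2.
Letter : Set
Letter = ℕ

Word : Set
Word = List Letter

data Shape : Set where
  empty : Shape
  node  : Shape → Shape → Shape

data LTree : Set where
  lempty : LTree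
  lnode  : LTree → Letter → LTree → LTree

shape : LTree → Shape
shape lempty = empty
shape (lnode l a r) = node (shape l) (shape r)

labels : LTree → List Letter
labels lempty = []
labels (lnode l a r) = labels l ++ a ∷ labels r

data RightStrictBST : LTree → Set where
  rsb-empty : RightStrictBST lempty
  rsb-node  : ∀ {l a r} →
              RightStrictBST l → RightStrictBST r →
              All (λ b → b ≤ a) (labels l) → All (λ b → a < b) (labels r) →
              RightStrictBST (lnode l a r)

postfix : LTree → Word
postfix lempty = []
postfix (lnode l a r) = postfix l ++ postfix r ++ [ a ]

IsPostfixReading : Shape → Word → Set
IsPostfixReading T w =
  ∃ λ (t : LTree) → RightStrictBST t × shape t ≡ T × postfix t ≡ w

HasInversion : ℕ → Word → Set
HasInversion i u =
  ∃ λ xs → ∃ λ ys → ∃ λ zs → u ≡ xs ++ suc i ∷ ys ++ i ∷ zs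

-- Quasi-Kashiwara operator f_i as a (functional) relation:
-- QuasiF i u v  iff  f̈_i(u) is defined and equals v
-- (no inversion, and v is u with its rightmost i replaced by i+1).
QuasiF : ℕ → Word → Word → Set
QuasiF i u v =
  ¬ HasInversion i u ×
  (∃ λ xs → ∃ λ ys → i ∉ ys × u ≡ xs ++ i ∷ ys × v ≡ xs ++ suc i ∷ ys)

HypoEdge : Word → Word → Set
HypoEdge u v = ∃ λ i → QuasiF i u v

Connected : Word → Word → Set
Connected = EqClosure HypoEdge

IsConnectedComponent : (Word → Set) → Set
IsConnectedComponent S =
  (∃ λ w → S w) ×
  (∀ u v → S u → ((S v → Connected u v) × (Connected u v → S v)))

-- The quasi-Kashiwara operators change a single letter without altering the
-- standardization of a word, and whether a word is the postfix reading of a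
-- right strict binary search tree of shape T depends only on its
-- standardization; moreover all such readings share one standardization.
-- Hence the readings of shape T are a union of components.  Conversely, the
-- operators ë_i lower the sum of the letters, so every word is connected to a
-- highest-weight word, and a highest-weight word is determined by its
-- standardization (induction on the letters, each letter i+1 lying to the
-- left of some letter i), so all readings of shape T are connected.
module Submission where

open import Defs
open import Data.Nat using (ℕ; zero; suc; _+_; _≤_; _<_; z≤n; s≤s; s≤s⁻¹; _≟_)
open import Data.Nat.Properties
open import Data.Nat.Induction using (<-wellFounded)
open import Data.List using (List; []; _∷_; _++_; [_]; map)
open import Data.Nat.ListAction using (sum)
open import Data.Nat.ListAction.Properties using (sum-++)
open import Data.List.Properties using (map-++; map-∘; map-cong-local; ∷-injective)
open import Data.List.Membership.Propositional using (_∈_; _∉_)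
open import Data.List.Membership.Propositional.Properties using (∈-∃++; ∈-map⁻; ∈-map⁺; ∈-++⁺ʳ; ∈-++⁺ˡ)
open import Data.List.Membership.DecPropositional _≟_ using (_∈?_)
open import Data.List.Relation.Unary.Any using (here; there)
open import Data.List.Relation.Unary.All as All using (All; []; _∷_)
import Data.List.Relation.Unary.All.Properties as Allₚ
open import Data.List.Relation.Unary.AllPairs as AllPairs using (AllPairs; []; _∷_)
import Data.List.Relation.Unary.AllPairs.Properties as AllPairsₚ
open import Data.List.Relation.Binary.Permutation.Propositional using (_↭_; prep; ↭-refl; ↭-sym; ↭-trans)
open import Data.List.Relation.Binary.Permutation.Propositional.Properties using (∷↭∷ʳ; All-resp-↭) renaming (++⁺ to ++⁺-↭)
open import Data.Product using (∃; ∃₂; _×_; _,_; proj₁; proj₂; swap; uncurry)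
open import Data.Sum using (_⊎_; inj₁; inj₂)
open import Function using (_∘_; _on_; id; const)
open import Induction.WellFounded using (Acc; acc)
open import Relation.Binary.Construct.On using (wellFounded)
open import Relation.Nullary using (¬_; Dec; yes; no; contradiction)
open import Relation.Binary.PropositionalEquality using (_≡_; refl; sym; trans; cong; cong₂; subst)
open import Relation.Binary.Construct.Closure.ReflexiveTransitive using (ε; _◅_; _◅◅_)
open import Relation.Binary.Construct.Closure.Symmetric using (fwd; bwd)
import Relation.Binary.Construct.Closure.Equivalence as EqClosure

private
  variable
    i : ℕ
    u v w : Word
    T : Shape

data Inversion (i : ℕ) : Word → Set where
  here  : ∀ {xs} → i ∈ xs → Inversion i (suc i ∷ xs)
  there : ∀ {x xs} → Inversion i xs → Inversion i (x ∷ xs)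

Inversion⇒HasInversion : Inversion i u → HasInversion i u
Inversion⇒HasInversion (here i∈xs) with ∈-∃++ i∈xs
... | ys , zs , refl = [] , ys , zs , refl
Inversion⇒HasInversion (there {x} inv) with Inversion⇒HasInversion inv
... | xs , ys , zs , refl = x ∷ xs , ys , zs , refl

HasInversion⇒Inversion : HasInversion i u → Inversion i u
HasInversion⇒Inversion ([] , ys , zs , refl) = here (∈-++⁺ʳ ys (here refl))
HasInversion⇒Inversion (x ∷ xs , ys , zs , refl) = there (HasInversion⇒Inversion (xs , ys , zs , refl))

inversion? : ∀ i u → Dec (Inversion i u)
inversion? i [] = no λ ()
inversion? i (x ∷ xs) with inversion? i xs
... | yes inv = yes (there inv)
... | no ¬inv with x ≟ suc i | i ∈? xs
...   | yes refl | yes i∈xs = yes (here i∈xs)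
...   | yes refl | no i∉xs  = no λ { (here i∈xs) → i∉xs i∈xs ; (there inv) → ¬inv inv }
...   | no x≢    | _        = no λ { (here _) → x≢ refl ; (there inv) → ¬inv inv }

Inversion⇒∈ : Inversion i u → i ∈ u
Inversion⇒∈ (here i∈xs) = there i∈xs
Inversion⇒∈ (there inv) = there (Inversion⇒∈ inv)

Inversion-++⁺ˡ : ∀ {xs} ys → Inversion i xs → Inversion i (xs ++ ys)
Inversion-++⁺ˡ ys (here i∈xs) = here (∈-++⁺ˡ i∈xs)
Inversion-++⁺ˡ ys (there inv) = there (Inversion-++⁺ˡ ys inv)

Inversion-++⁺ʳ : ∀ xs {ys} → Inversion i ys → Inversion i (xs ++ ys)
Inversion-++⁺ʳ [] inv = inv
Inversion-++⁺ʳ (x ∷ xs) inv = there (Inversion-++⁺ʳ xs inv)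

Inversion-++⁺ : ∀ {xs ys} → suc i ∈ xs → i ∈ ys → Inversion i (xs ++ ys)
Inversion-++⁺ {xs = _ ∷ xs} (here refl) i∈ys = here (∈-++⁺ʳ xs i∈ys)
Inversion-++⁺ (there si∈xs) i∈ys = there (Inversion-++⁺ si∈xs i∈ys)

Inversion-++⁻ : ∀ xs {ys} → Inversion i (xs ++ ys) → Inversion i xs ⊎ suc i ∈ xs ⊎ Inversion i ys
Inversion-++⁻ [] inv = inj₂ (inj₂ inv)
Inversion-++⁻ (x ∷ xs) (here _) = inj₂ (inj₁ (here refl))
Inversion-++⁻ (x ∷ xs) (there inv) with Inversion-++⁻ xs inv
... | inj₁ inv′ = inj₁ (there inv′)
... | inj₂ (inj₁ si∈xs) = inj₂ (inj₁ (there si∈xs))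
... | inj₂ (inj₂ inv′) = inj₂ (inj₂ inv′)

-- Standardization

-- Two words of equal length are encoded by the list of their letters paired
-- position by position; they have the same standardization when every
-- earlier pair is Concordant with every later one.
Concordant : ℕ × ℕ → ℕ × ℕ → Set
Concordant x y =
  (proj₁ x ≤ proj₁ y → proj₂ x ≤ proj₂ y) × (proj₂ x ≤ proj₂ y → proj₁ x ≤ proj₁ y)

SameStd : Word → Word → Set
SameStd u v = ∃ λ ps → AllPairs Concordant ps × map proj₁ ps ≡ u × map proj₂ ps ≡ v

≤∧≤⇒concordant : ∀ {x y} → proj₁ x ≤ proj₁ y → proj₂ x ≤ proj₂ y → Concordant x y
≤∧≤⇒concordant x₁≤y₁ x₂≤y₂ = const x₂≤y₂ , const x₁≤y₁

>∧>⇒concordant : ∀ {x y} → proj₁ y < proj₁ x → proj₂ y < proj₂ x → Concordant x y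
>∧>⇒concordant y₁<x₁ y₂<x₂ =
  (λ x₁≤y₁ → contradiction x₁≤y₁ (<⇒≱ y₁<x₁)) , (λ x₂≤y₂ → contradiction x₂≤y₂ (<⇒≱ y₂<x₂))

concordant⇒> : ∀ {x y} → Concordant x y → proj₁ y < proj₁ x → proj₂ y < proj₂ x
concordant⇒> (_ , reflects) y₁<x₁ = ≰⇒> (λ x₂≤y₂ → <⇒≱ y₁<x₁ (reflects x₂≤y₂))

AllPairs-concordant-swap : ∀ {ps} → AllPairs Concordant ps → AllPairs Concordant (map swap ps)
AllPairs-concordant-swap c = AllPairsₚ.map⁺ (AllPairs.map swap c)

SameStd-sym : SameStd u v → SameStd v u
SameStd-sym (ps , c , refl , refl) = map swap ps , AllPairs-concordant-swap c , sym (map-∘ ps) , sym (map-∘ ps)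

diagonal : ℕ → ℕ × ℕ
diagonal c = c , c

AllPairs-diagonal : ∀ xs → AllPairs Concordant (map diagonal xs)
AllPairs-diagonal [] = []
AllPairs-diagonal (x ∷ xs) = Allₚ.map⁺ (All.universal (λ _ → id , id) xs) ∷ AllPairs-diagonal xs

map-diagonal : ∀ (π : ℕ × ℕ → ℕ) → (∀ c → π (diagonal c) ≡ c) →
  ∀ xs → map π (map diagonal xs) ≡ xs
map-diagonal π π-diag [] = refl
map-diagonal π π-diag (x ∷ xs) = cong₂ _∷_ (π-diag x) (map-diagonal π π-diag xs)

map-diagonal-splice : ∀ (π : ℕ × ℕ → ℕ) → (∀ c → π (diagonal c) ≡ c) → ∀ xs p ys →
  map π (map diagonal xs ++ p ∷ map diagonal ys) ≡ xs ++ π p ∷ ys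
map-diagonal-splice π π-diag xs p ys =
  trans (map-++ π (map diagonal xs) _)
        (cong₂ (λ as bs → as ++ π p ∷ bs) (map-diagonal π π-diag xs) (map-diagonal π π-diag ys))

QuasiF⇒SameStd : QuasiF i u v → SameStd u v
QuasiF⇒SameStd {i} (no-inversion , xs , ys , i∉ys , refl , refl) =
  map diagonal xs ++ (i , suc i) ∷ map diagonal ys ,
  AllPairsₚ.++⁺ (AllPairs-diagonal xs) (raised-vs-suffix ∷ AllPairs-diagonal ys) prefix-vs-rest ,
  map-diagonal-splice proj₁ (λ _ → refl) xs _ ys ,
  map-diagonal-splice proj₂ (λ _ → refl) xs _ ys
  where
  raised-vs-suffix : All (Concordant (i , suc i)) (map diagonal ys)
  raised-vs-suffix = Allₚ.map⁺ (All.tabulate λ d∈ys →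
    (λ i≤d → ≤∧≢⇒< i≤d (λ i≡d → i∉ys (subst (_∈ ys) (sym i≡d) d∈ys))) , ≤-trans (n≤1+n i))
  prefix-vs-raised : ∀ {c} → c ∈ xs → Concordant (c , c) (i , suc i)
  prefix-vs-raised c∈xs = m≤n⇒m≤1+n , λ c≤1+i → s≤s⁻¹ (≤∧≢⇒< c≤1+i λ c≡1+i →
    no-inversion (Inversion⇒HasInversion (Inversion-++⁺ (subst (_∈ xs) c≡1+i c∈xs) (here refl))))
  prefix-vs-rest : All (λ x → All (Concordant x) ((i , suc i) ∷ map diagonal ys)) (map diagonal xs)
  prefix-vs-rest = Allₚ.map⁺ (All.tabulate λ c∈xs →
    prefix-vs-raised c∈xs ∷ Allₚ.map⁺ (All.universal (λ _ → id , id) ys))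

map-++⁻ : ∀ {A B : Set} (f : A → B) ps xs {ys} → map f ps ≡ xs ++ ys →
  ∃₂ λ p₁ p₂ → ps ≡ p₁ ++ p₂ × map f p₁ ≡ xs × map f p₂ ≡ ys
map-++⁻ f ps [] eq = [] , ps , refl , refl , eq
map-++⁻ f (p ∷ ps) (x ∷ xs) eq with ∷-injective eq
... | fp≡x , eq′ with map-++⁻ f ps xs eq′
... | p₁ , p₂ , refl , eq₁ , eq₂ = p ∷ p₁ , p₂ , refl , cong₂ _∷_ fp≡x eq₁ , eq₂

map-proj₁-++-∷ʳ⁻ : ∀ ps xs ys a → map proj₁ ps ≡ xs ++ ys ++ [ a ] →
  ∃₂ λ (p₁ p₂ : List (ℕ × ℕ)) → ∃ λ (b : ℕ) →
    ps ≡ p₁ ++ p₂ ++ [ (a , b) ] × map proj₁ p₁ ≡ xs × map proj₁ p₂ ≡ ys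
map-proj₁-++-∷ʳ⁻ ps xs ys a eq with map-++⁻ proj₁ ps xs eq
... | p₁ , q , refl , eq₁ , eq′ with map-++⁻ proj₁ q ys eq′
...   | p₂ , [] , refl , eq₂ , ()
...   | p₂ , _ ∷ _ ∷ _ , refl , eq₂ , ()
...   | p₂ , (.a , b) ∷ [] , refl , eq₂ , refl = p₁ , p₂ , b , refl , eq₁ , eq₂

map-++-∷ʳ : ∀ {A B : Set} (f : A → B) xs ys z → map f (xs ++ ys ++ [ z ]) ≡ map f xs ++ map f ys ++ [ f z ]
map-++-∷ʳ f xs ys z = trans (map-++ f xs _) (cong (map f xs ++_) (map-++ f ys _))

AllPairs-++⁻ : ∀ {A : Set} {R : A → A → Set} xs {ys} → AllPairs R (xs ++ ys) →
  AllPairs R xs × AllPairs R ys × All (λ x → All (R x) ys) xs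
AllPairs-++⁻ [] rs = [] , rs , []
AllPairs-++⁻ (x ∷ xs) (rx ∷ rs) with AllPairs-++⁻ xs rs
... | rxs , rys , cross = Allₚ.++⁻ˡ xs rx ∷ rxs , rys , Allₚ.++⁻ʳ xs rx ∷ cross

-- Postfix readings depend only on the standardization

postfix↭labels : ∀ t → postfix t ↭ labels t
postfix↭labels lempty = ↭-refl
postfix↭labels (lnode l a r) =
  ++⁺-↭ (postfix↭labels l) (↭-trans (↭-sym (∷↭∷ʳ a (postfix r))) (prep a (postfix↭labels r)))

node-injective : ∀ {l r l′ r′} → node l r ≡ node l′ r′ → l ≡ l′ × r ≡ r′
node-injective refl = refl , refl

relabel-bound : ∀ {P Q : ℕ → Set} {y} t t′ ps →
  (∀ {x} → Concordant x y → P (proj₁ x) → Q (proj₂ x)) → All (λ x → Concordant x y) ps →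
  map proj₁ ps ≡ postfix t → postfix t′ ≡ map proj₂ ps → All P (labels t) → All Q (labels t′)
relabel-bound {P} {Q} t t′ ps transfer concordant eq eq′ Pt =
  All-resp-↭ (postfix↭labels t′) (subst (All Q) (sym eq′) (Allₚ.map⁺ (All.zipWith
    (λ { (c , px) → transfer c px })
    (concordant , Allₚ.map⁻ (subst (All P) (sym eq) (All-resp-↭ (↭-sym (postfix↭labels t)) Pt))))))

RightStrictBST-relabel : ∀ t → RightStrictBST t →
  ∀ ps → AllPairs Concordant ps → map proj₁ ps ≡ postfix t →
  ∃ λ t′ → RightStrictBST t′ × shape t′ ≡ shape t × postfix t′ ≡ map proj₂ ps
RightStrictBST-relabel lempty _ [] _ _ = lempty , rsb-empty , refl , refl
RightStrictBST-relabel (lnode l a r) (rsb-node bst-l bst-r l≤a a<r) ps c eq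
  with map-proj₁-++-∷ʳ⁻ ps (postfix l) (postfix r) a eq
... | p₁ , p₂ , b , refl , eq₁ , eq₂ with AllPairs-++⁻ p₁ c
... | c₁ , c₂₃ , c₁-vs-rest with AllPairs-++⁻ p₂ c₂₃
... | c₂ , _ , c₂-vs-root
  with RightStrictBST-relabel l bst-l p₁ c₁ eq₁ | RightStrictBST-relabel r bst-r p₂ c₂ eq₂
... | l′ , bst-l′ , shape-l′ , postfix-l′ | r′ , bst-r′ , shape-r′ , postfix-r′ =
  lnode l′ b r′ ,
  rsb-node bst-l′ bst-r′
    (relabel-bound l l′ p₁ proj₁ (All.map (proj₂ ∘ Allₚ.∷ʳ⁻) c₁-vs-rest) eq₁ postfix-l′ l≤a)
    (relabel-bound r r′ p₂ concordant⇒> (All.map All.head c₂-vs-root) eq₂ postfix-r′ a<r) ,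
  cong₂ node shape-l′ shape-r′ ,
  trans (cong₂ (λ xs ys → xs ++ ys ++ [ b ]) postfix-l′ postfix-r′)
        (sym (map-++-∷ʳ proj₂ p₁ p₂ (a , b)))

SameStd-preserves-reading : SameStd u v → IsPostfixReading T u → IsPostfixReading T v
SameStd-preserves-reading (ps , c , eq₁ , eq₂) (t , bst , refl , refl)
  with RightStrictBST-relabel t bst ps c eq₁
... | t′ , bst′ , shape-t′ , postfix-t′ = t′ , bst′ , shape-t′ , trans postfix-t′ eq₂

Connected-preserves-reading : Connected u v → IsPostfixReading T u → IsPostfixReading T v
Connected-preserves-reading ε reading = reading
Connected-preserves-reading (fwd (_ , f) ◅ path) reading =
  Connected-preserves-reading path (SameStd-preserves-reading (QuasiF⇒SameStd f) reading)
Connected-preserves-reading (bwd (_ , f) ◅ path) reading =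
  Connected-preserves-reading path (SameStd-preserves-reading (SameStd-sym (QuasiF⇒SameStd f)) reading)

-- Readings of the same shape have the same standardization

postfixPairs : LTree → LTree → List (ℕ × ℕ)
postfixPairs (lnode l₁ a r₁) (lnode l₂ b r₂) = postfixPairs l₁ l₂ ++ postfixPairs r₁ r₂ ++ [ (a , b) ]
postfixPairs _ _ = []

postfixPairs-proj₁ : ∀ t₁ t₂ → shape t₁ ≡ shape t₂ → map proj₁ (postfixPairs t₁ t₂) ≡ postfix t₁
postfixPairs-proj₁ lempty lempty _ = refl
postfixPairs-proj₁ (lnode l₁ a r₁) (lnode l₂ b r₂) eq with node-injective eq
... | eq-l , eq-r = trans (map-++-∷ʳ proj₁ (postfixPairs l₁ l₂) _ _)
  (cong₂ (λ xs ys → xs ++ ys ++ [ a ]) (postfixPairs-proj₁ l₁ l₂ eq-l) (postfixPairs-proj₁ r₁ r₂ eq-r))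

postfixPairs-proj₂ : ∀ t₁ t₂ → shape t₁ ≡ shape t₂ → map proj₂ (postfixPairs t₁ t₂) ≡ postfix t₂
postfixPairs-proj₂ lempty lempty _ = refl
postfixPairs-proj₂ (lnode l₁ a r₁) (lnode l₂ b r₂) eq with node-injective eq
... | eq-l , eq-r = trans (map-++-∷ʳ proj₂ (postfixPairs l₁ l₂) _ _)
  (cong₂ (λ xs ys → xs ++ ys ++ [ b ]) (postfixPairs-proj₂ l₁ l₂ eq-l) (postfixPairs-proj₂ r₁ r₂ eq-r))

All-postfixPairs : ∀ {P Q : ℕ → Set} t₁ t₂ → All P (labels t₁) → All Q (labels t₂) →
  All (λ x → P (proj₁ x) × Q (proj₂ x)) (postfixPairs t₁ t₂)
All-postfixPairs lempty _ _ _ = []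
All-postfixPairs (lnode _ _ _) lempty _ _ = []
All-postfixPairs (lnode l₁ a r₁) (lnode l₂ b r₂) P₁ Q₂
  with Allₚ.++⁻ (labels l₁) P₁ | Allₚ.++⁻ (labels l₂) Q₂
... | Pl₁ , Pa ∷ Pr₁ | Ql₂ , Qb ∷ Qr₂ =
  Allₚ.++⁺ (All-postfixPairs l₁ l₂ Pl₁ Ql₂)
           (Allₚ.++⁺ (All-postfixPairs r₁ r₂ Pr₁ Qr₂) ((Pa , Qb) ∷ []))

AllPairs-postfixPairs : ∀ t₁ t₂ → RightStrictBST t₁ → RightStrictBST t₂ →
  AllPairs Concordant (postfixPairs t₁ t₂)
AllPairs-postfixPairs lempty _ _ _ = []
AllPairs-postfixPairs (lnode _ _ _) lempty _ _ = []
AllPairs-postfixPairs (lnode l₁ a r₁) (lnode l₂ b r₂)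
  (rsb-node bst-l₁ bst-r₁ l₁≤a a<r₁) (rsb-node bst-l₂ bst-r₂ l₂≤b b<r₂) =
  AllPairsₚ.++⁺ (AllPairs-postfixPairs l₁ l₂ bst-l₁ bst-l₂)
    (AllPairsₚ.++⁺ (AllPairs-postfixPairs r₁ r₂ bst-r₁ bst-r₂) ([] ∷ []) right-vs-root)
    left-vs-rest
  where
  right-vs-root : All (λ x → All (Concordant x) [ (a , b) ]) (postfixPairs r₁ r₂)
  right-vs-root = All.map (λ { (a<x₁ , b<x₂) → >∧>⇒concordant a<x₁ b<x₂ ∷ [] })
    (All-postfixPairs r₁ r₂ a<r₁ b<r₂)
  left-vs-rest : All (λ x → All (Concordant x) (postfixPairs r₁ r₂ ++ [ (a , b) ])) (postfixPairs l₁ l₂)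
  left-vs-rest = All.map (λ { (x₁≤a , x₂≤b) → Allₚ.++⁺
      (All.map (λ { (a<y₁ , b<y₂) →
          ≤∧≤⇒concordant (≤-trans x₁≤a (<⇒≤ a<y₁)) (≤-trans x₂≤b (<⇒≤ b<y₂)) })
        (All-postfixPairs r₁ r₂ a<r₁ b<r₂))
      (≤∧≤⇒concordant x₁≤a x₂≤b ∷ []) })
    (All-postfixPairs l₁ l₂ l₁≤a l₂≤b)

readings-SameStd : IsPostfixReading T u → IsPostfixReading T v → SameStd u v
readings-SameStd (t₁ , bst₁ , shape₁ , refl) (t₂ , bst₂ , shape₂ , refl) =
  postfixPairs t₁ t₂ , AllPairs-postfixPairs t₁ t₂ bst₁ bst₂ ,
  postfixPairs-proj₁ t₁ t₂ same-shape , postfixPairs-proj₂ t₁ t₂ same-shape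
  where
  same-shape = trans shape₁ (sym shape₂)

size : Shape → ℕ
size empty = 0
size (node l r) = suc (size l + size r)

inorderTree : Shape → ℕ → LTree
inorderTree empty k = lempty
inorderTree (node l r) k = lnode (inorderTree l k) (k + size l) (inorderTree r (suc (k + size l)))

shape-inorderTree : ∀ s k → shape (inorderTree s k) ≡ s
shape-inorderTree empty k = refl
shape-inorderTree (node l r) k = cong₂ node (shape-inorderTree l k) (shape-inorderTree r _)

inorderTree-bounds : ∀ s k → All (λ x → k ≤ x × x < k + size s) (labels (inorderTree s k))
inorderTree-bounds empty k = []
inorderTree-bounds (node l r) k =
  Allₚ.++⁺ (All.map (λ { (k≤x , x<) → k≤x , <-trans x< root<total }) (inorderTree-bounds l k))
    ((m≤m+n k (size l) , root<total) ∷
     All.map (λ { (root<x , x<) →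
         ≤-trans (m≤m+n k (size l)) (<⇒≤ root<x) , <-≤-trans x< (≤-reflexive right-end) })
       (inorderTree-bounds r (suc (k + size l))))
  where
  root<total : k + size l < k + size (node l r)
  root<total = +-monoʳ-< k (s≤s (m≤m+n (size l) (size r)))
  right-end : suc (k + size l) + size r ≡ k + size (node l r)
  right-end = sym (trans (+-suc k _) (cong suc (sym (+-assoc k (size l) (size r)))))

inorderTree-rsbst : ∀ s k → RightStrictBST (inorderTree s k)
inorderTree-rsbst empty k = rsb-empty
inorderTree-rsbst (node l r) k =
  rsb-node (inorderTree-rsbst l k) (inorderTree-rsbst r _)
    (All.map (<⇒≤ ∘ proj₂) (inorderTree-bounds l k)) (All.map proj₁ (inorderTree-bounds r _))

reading-exists : ∀ T → ∃ (IsPostfixReading T)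
reading-exists T = postfix (inorderTree T 0) , inorderTree T 0 , inorderTree-rsbst T 0 , shape-inorderTree T 0 , refl

-- Highest-weight words

-- ë_i w is undefined for every i.
HighestWeight : Word → Set
HighestWeight w = ∀ i → suc i ∈ w → Inversion i w

LowerBoundAt : ℕ → ℕ × ℕ → Set
LowerBoundAt j x = proj₁ x ≡ j → j ≤ proj₂ x

-- A letter i+1 to the left of a letter i is paired with a larger letter than
-- that i; every later i+1 is paired with a letter at least as large.
LowerBoundAt-suc : ∀ ps → AllPairs Concordant ps → All (LowerBoundAt i) ps →
  Inversion i (map proj₁ ps) → All (LowerBoundAt (suc i)) ps
LowerBoundAt-suc {i} ((a , b) ∷ ps) (head ∷ c) (_ ∷ bounds) inversion =
  head-bound inversion ∷ tail-bounds inversion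
  where
  above-i : a ≡ suc i → i ∈ map proj₁ ps → suc i ≤ b
  above-i refl i∈ with ∈-map⁻ proj₁ i∈
  ... | y , y∈ , refl = ≤-<-trans (All.lookup bounds y∈ refl) (concordant⇒> (All.lookup head y∈) (n<1+n i))
  head-bound : Inversion i (a ∷ map proj₁ ps) → LowerBoundAt (suc i) (a , b)
  head-bound (here i∈) _ = above-i refl i∈
  head-bound (there inv) a≡ = above-i a≡ (Inversion⇒∈ inv)
  tail-bounds : Inversion i (a ∷ map proj₁ ps) → All (LowerBoundAt (suc i)) ps
  tail-bounds (here i∈) = All.map (λ { (preserves , _) x₁≡ →
    ≤-trans (above-i refl i∈) (preserves (≤-reflexive (sym x₁≡))) }) head
  tail-bounds (there inv) = LowerBoundAt-suc ps c bounds inv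

HighestWeight⇒≤ : ∀ ps → AllPairs Concordant ps → HighestWeight (map proj₁ ps) →
  All (λ x → proj₁ x ≤ proj₂ x) ps
HighestWeight⇒≤ ps c hw = All.tabulate λ {x} x∈ → All.lookup (bound (proj₁ x)) x∈ refl
  where
  bound : ∀ j → All (LowerBoundAt j) ps
  bound zero = All.universal (λ _ _ → z≤n) ps
  bound (suc j) = All.tabulate λ {x} x∈ x₁≡ →
    let sj∈ = subst (_∈ map proj₁ ps) x₁≡ (∈-map⁺ proj₁ x∈)
    in All.lookup (LowerBoundAt-suc ps c (bound j) (hw j sj∈)) x∈ x₁≡

HighestWeight-unique : HighestWeight u → HighestWeight v → SameStd u v → u ≡ v
HighestWeight-unique hu hv (ps , c , refl , refl) =
  map-cong-local (All.zipWith (uncurry ≤-antisym) (HighestWeight⇒≤ ps c hu , Allₚ.map⁻ swapped))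
  where
  swapped : All (λ x → proj₁ x ≤ proj₂ x) (map swap ps)
  swapped = HighestWeight⇒≤ (map swap ps) (AllPairs-concordant-swap c) (subst HighestWeight (map-∘ ps) hv)

-- Every word is connected to a highest-weight word

HighestWeight⊎lowerable : ∀ ys w →
  (∀ i → suc i ∈ ys → Inversion i w) ⊎ ∃ λ i → suc i ∈ ys × ¬ Inversion i w
HighestWeight⊎lowerable [] w = inj₁ λ _ ()
HighestWeight⊎lowerable (zero ∷ ys) w with HighestWeight⊎lowerable ys w
... | inj₁ hw = inj₁ λ { i (there si∈) → hw i si∈ }
... | inj₂ (i , si∈ , ¬inv) = inj₂ (i , there si∈ , ¬inv)
HighestWeight⊎lowerable (suc j ∷ ys) w with inversion? j w
... | no ¬inv = inj₂ (j , here refl , ¬inv)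
... | yes inv with HighestWeight⊎lowerable ys w
...   | inj₁ hw = inj₁ λ { i (here refl) → inv ; i (there si∈) → hw i si∈ }
...   | inj₂ (i , si∈ , ¬inv) = inj₂ (i , there si∈ , ¬inv)

∈⇒leftmost-split : ∀ {x : ℕ} {w} → x ∈ w → ∃₂ λ xs ys → w ≡ xs ++ x ∷ ys × x ∉ xs
∈⇒leftmost-split {w = y ∷ ys} (here refl) = [] , ys , refl , λ ()
∈⇒leftmost-split {x} {y ∷ ys} (there x∈) with y ≟ x
... | yes refl = [] , ys , refl , λ ()
... | no y≢x with ∈⇒leftmost-split x∈
...   | xs , zs , refl , x∉xs =
  y ∷ xs , zs , refl , λ { (here x≡y) → y≢x (sym x≡y) ; (there x∈xs) → x∉xs x∈xs }

-- w′ is ë_i w: the leftmost i+1 of w lowered to i.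
lower-leftmost : suc i ∈ w → ¬ Inversion i w → ∃ λ w′ → QuasiF i w′ w × sum w′ < sum w
lower-leftmost {i} si∈w ¬inv with ∈⇒leftmost-split si∈w
... | xs , ys , refl , si∉xs =
  xs ++ i ∷ ys ,
  (no-inversion , xs , ys , (λ i∈ys → ¬inv (Inversion-++⁺ʳ xs (here i∈ys))) , refl , refl) ,
  sum-smaller
  where
  no-inversion : ¬ HasInversion i (xs ++ i ∷ ys)
  no-inversion has with Inversion-++⁻ xs (HasInversion⇒Inversion has)
  ... | inj₁ inv = ¬inv (Inversion-++⁺ˡ _ inv)
  ... | inj₂ (inj₁ si∈xs) = si∉xs si∈xs
  ... | inj₂ (inj₂ (there inv)) = ¬inv (Inversion-++⁺ʳ xs (there inv))
  sum-smaller : sum (xs ++ i ∷ ys) < sum (xs ++ suc i ∷ ys)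
  sum-smaller rewrite sum-++ xs (i ∷ ys) | sum-++ xs (suc i ∷ ys) =
    +-monoʳ-< (sum xs) (n<1+n (i + sum ys))

connected-to-HighestWeight : ∀ w → ∃ λ h → HighestWeight h × Connected w h
connected-to-HighestWeight w = go w (wellFounded sum <-wellFounded w)
  where
  go : ∀ w → Acc (_<_ on sum) w → ∃ λ h → HighestWeight h × Connected w h
  go w (acc smaller) with HighestWeight⊎lowerable w w
  ... | inj₁ hw = w , hw , ε
  ... | inj₂ (i , si∈w , ¬inv) with lower-leftmost si∈w ¬inv
  ...   | w′ , f , lt with go w′ (smaller lt)
  ...     | h , hw , path = h , hw , bwd (i , f) ◅ path

readings-connected : IsPostfixReading T u → IsPostfixReading T v → Connected u v
readings-connected {u = u} {v = v} reading-u reading-v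
  with connected-to-HighestWeight u | connected-to-HighestWeight v
... | h , hw , u~h | h′ , hw′ , v~h′
  with HighestWeight-unique hw hw′ (readings-SameStd (Connected-preserves-reading u~h reading-u)
                                                     (Connected-preserves-reading v~h′ reading-v))
... | refl = u~h ◅◅ EqClosure.symmetric HypoEdge v~h′

proposition10 : (l r : Shape) → IsConnectedComponent (IsPostfixReading (node l r))
proposition10 l r =
  reading-exists (node l r) ,
  λ u v reading-u → readings-connected reading-u , λ u~v → Connected-preserves-reading u~v reading-u
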